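{- Every satisfiable $\mathrm{LRP}$ formula is satisfied by a finite graph.
   Context: A vocabulary is $\tau=\langle C,U,F\rangle$, where $C$ is a finite set of constant symbols, $U$ a set of unary relation symbols and $F$ a finite set of binary relation symbols (edge labels). A graph (interpretation) over $\tau$ is $G=\langle V,E,C^G,U^G\rangle$ with $V$ a set of nodes, $E(f)\subseteq V\times V$ for $f\in F$, $C^G(c)\in V$ for $c\in C$, and $U^G(u)\subseteq V$ for $u\in U$. Terms are variables or constants; atomic formulas are $t=t'$, $u(t)$ and $t\xrightarrow{f}t'$ (meaning $(t,t')\in E(f)$); quantifier-free formulas are Boolean combinations of atomic formulas. Routing expressions are given by the grammar $R::=\emptyset\mid\epsilon\mid \xrightarrow{f}\mid \xleftarrow{f}\mid u\mid\neg u\mid c\mid \neg c\mid R_1.R_2\mid R_1|R_2\mid R^*$ ($f\in F,u\in U,c\in C$), denoting a language $L(R)$ of words over the letters $\xrightarrow{f},\xleftarrow{f},u,\neg u,c,\neg c$. A path labelled by a word $w$ from node $a$ to node $b$ is defined by: $\epsilon$: $a=b$; $\xrightarrow{f}$: $(a,b)\in E(f)$; $\xleftarrow{f}$: $(b,a)\in E(f)$; $u$: $a=b\in U^G(u)$; $\neg u$: $a=b\notin U^G(u)$; $c$: $a=b=C^G(c)$; $\neg c$: $a=b\neq C^G(c)$; and a word $w_1w_2$ labels a path from $a$ to $b$ iff there is a node $d$ with a $w_1$-path from $a$ to $d$ and a $w_2$-path from $d$ to $b$. An $R$-path is a path labelled by some word of $L(R)$. A neighborhood formula $N(v_0,\dots,v_n)$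 is a conjunction of edge atoms $v_i\xrightarrow{f}v_j$. A reachability constraint, written $[c,R]p$, is a closed formula $\forall v_0,\dots,v_n.\ R(c,v_0)\Rightarrow(N(v_0,\dots,v_n)\Rightarrow\psi(v_0,\dots,v_n))$ where $c\in C$, $R$ is a routing expression, $N$ is a neighborhood formula, $\psi$ is quantifier-free, the free variables of $N$ are among $v_0,\dots,v_n$ and those of $\psi$ are among $FV(N)\cup\{v_0\}$; $p(v_0):=N\Rightarrow\psi$ is its pattern. A graph $G$ satisfies it iff for every node $a$ reachable by an $R$-path from $C^G(c)$ and every assignment of nodes to $v_0,\dots,v_n$ with $v_0\mapsto a$, the assignment satisfies $N\Rightarrow\psi$. An $\mathrm{LRP}$ formula is a Boolean combination of reachability constraints, with the usual semantics of Boolean connectives. -}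

module Defs where

open import Data.Nat using (ℕ; zero; suc)
open import Data.Fin using (Fin; zero; suc)
open import Data.List using (List; []; _∷_; _++_)
open import Data.List.Relation.Unary.Any using (Any)
open import Data.Product using (Σ; ∃; _×_; _,_)
open import Data.Sum using (_⊎_)
open import Data.Unit using (⊤)
open import Data.Empty using (⊥)
open import Relation.Nullary using (¬_)
open import Relation.Binary.PropositionalEquality using (_≡_)
open import Function.Bundles using (_↔_)

record Vocabulary : Set₁ where
  field
    nC : ℕ
    nF : ℕ
    U  : Set
  C : Set
  C = Fin nC
  F : Set
  F = Fin nF

module _ (τ : Vocabulary) where
  open Vocabulary τ

  record Graph : Set₁ where
    field
      V  : Set
      E  : F → V → V → Set
      CG : C → V
      UG : U → V → Set

  IsFinite : Graph → Set
  IsFinite G = ∃ λ (n : ℕ) → Graph.V G ↔ Fin n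

  data Letter : Set where
    fwd  : F → Letter
    bwd  : F → Letter
    pos  : U → Letter
    neg  : U → Letter
    isC  : C → Letter
    notC : C → Letter

  data RExp : Set where
    ∅     : RExp
    ε     : RExp
    fwd   : F → RExp
    bwd   : F → RExp
    pos   : U → RExp
    neg   : U → RExp
    isC   : C → RExp
    notC  : C → RExp
    _∙_   : RExp → RExp → RExp
    _∣_   : RExp → RExp → RExp
    _⋆    : RExp → RExp

  data InL : RExp → List Letter → Set where
    ε-in    : InL ε []
    fwd-in  : ∀ f → InL (fwd f) (fwd f ∷ [])
    bwd-in  : ∀ f → InL (bwd f) (bwd f ∷ [])
    pos-in  : ∀ u → InL (pos u) (pos u ∷ [])
    neg-in  : ∀ u → InL (neg u) (neg u ∷ [])
    isC-in  : ∀ c → InL (isC c) (isC c ∷ [])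
    notC-in : ∀ c → InL (notC c) (notC c ∷ [])
    ∙-in    : ∀ {R₁ R₂ w₁ w₂} → InL R₁ w₁ → InL R₂ w₂ → InL (R₁ ∙ R₂) (w₁ ++ w₂)
    ∣-inˡ   : ∀ {R₁ R₂ w} → InL R₁ w → InL (R₁ ∣ R₂) w
    ∣-inʳ   : ∀ {R₁ R₂ w} → InL R₂ w → InL (R₁ ∣ R₂) w
    ⋆-nil   : ∀ {R} → InL (R ⋆) []
    ⋆-cons  : ∀ {R w₁ w₂} → InL R w₁ → InL (R ⋆) w₂ → InL (R ⋆) (w₁ ++ w₂)

  module _ (G : Graph) where
    open Graph G

    LetterPath : Letter → V → V → Set
    LetterPath (fwd f)  a b = E f a b
    LetterPath (bwd f)  a b = E f b a
    LetterPath (pos u)  a b = (a ≡ b) × UG u a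
    LetterPath (neg u)  a b = (a ≡ b) × ¬ UG u a
    LetterPath (isC c)  a b = (a ≡ b) × (b ≡ CG c)
    LetterPath (notC c) a b = (a ≡ b) × ¬ (a ≡ CG c)

    WordPath : List Letter → V → V → Set
    WordPath []      a b = a ≡ b
    WordPath (l ∷ w) a b = Σ V λ d → LetterPath l a d × WordPath w d b

    RPath : RExp → V → V → Set
    RPath R a b = Σ (List Letter) λ w → InL R w × WordPath w a b

  data Term (n : ℕ) : Set where
    var   : Fin (suc n) → Term n
    const : C → Term n

  data QF (n : ℕ) : Set where
    _≐_    : Term n → Term n → QF n
    unary  : U → Term n → QF n
    edge   : Term n → F → Term n → QF n
    true   : QF n
    false  : QF n
    ¬'_    : QF n → QF n
    _∧'_   : QF n → QF n → QF n
    _∨'_   : QF n → QF n → QF n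
    _⇒'_   : QF n → QF n → QF n

  data OccT {n : ℕ} (i : Fin (suc n)) : Term n → Set where
    here : OccT i (var i)

  data OccQF {n : ℕ} (i : Fin (suc n)) : QF n → Set where
    ≐ˡ    : ∀ {t t'} → OccT i t → OccQF i (t ≐ t')
    ≐ʳ    : ∀ {t t'} → OccT i t' → OccQF i (t ≐ t')
    un    : ∀ {u t} → OccT i t → OccQF i (unary u t)
    edgeˡ : ∀ {t f t'} → OccT i t → OccQF i (edge t f t')
    edgeʳ : ∀ {t f t'} → OccT i t' → OccQF i (edge t f t')
    neg   : ∀ {φ} → OccQF i φ → OccQF i (¬' φ)
    ∧ˡ    : ∀ {φ ψ} → OccQF i φ → OccQF i (φ ∧' ψ)
    ∧ʳ    : ∀ {φ ψ} → OccQF i ψ → OccQF i (φ ∧' ψ)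
    ∨ˡ    : ∀ {φ ψ} → OccQF i φ → OccQF i (φ ∨' ψ)
    ∨ʳ    : ∀ {φ ψ} → OccQF i ψ → OccQF i (φ ∨' ψ)
    ⇒ˡ    : ∀ {φ ψ} → OccQF i φ → OccQF i (φ ⇒' ψ)
    ⇒ʳ    : ∀ {φ ψ} → OccQF i ψ → OccQF i (φ ⇒' ψ)

  -- Neighborhood formula: conjunction of edge atoms vᵢ →f vⱼ (list of triples)
  Neighborhood : ℕ → Set
  Neighborhood n = List (Fin (suc n) × F × Fin (suc n))

  OccN : ∀ {n} → Fin (suc n) → Neighborhood n → Set
  OccN i N = Any (λ { (j , f , k) → (i ≡ j) ⊎ (i ≡ k) }) N

  record Constraint : Set where
    field
      c   : C
      R   : RExp
      n   : ℕ
      N   : Neighborhood n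
      ψ   : QF n
      wf  : ∀ i → OccQF i ψ → (i ≡ zero) ⊎ OccN i N

  data LRP : Set where
    [_]   : Constraint → LRP
    ⊤'    : LRP
    ⊥'    : LRP
    ~_    : LRP → LRP
    _&_   : LRP → LRP → LRP
    _∥_   : LRP → LRP → LRP
    _⟹_  : LRP → LRP → LRP

  module _ (G : Graph) where
    open Graph G

    ⟦_⟧T : ∀ {n} → Term n → (Fin (suc n) → V) → V
    ⟦ var i ⟧T ρ   = ρ i
    ⟦ const c ⟧T ρ = CG c

    SatQF : ∀ {n} → (Fin (suc n) → V) → QF n → Set
    SatQF ρ (t ≐ t')     = ⟦ t ⟧T ρ ≡ ⟦ t' ⟧T ρ
    SatQF ρ (unary u t)  = UG u (⟦ t ⟧T ρ)
    SatQF ρ (edge t f t') = E f (⟦ t ⟧T ρ) (⟦ t' ⟧T ρ)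
    SatQF ρ true         = ⊤
    SatQF ρ false        = ⊥
    SatQF ρ (¬' φ)       = ¬ SatQF ρ φ
    SatQF ρ (φ ∧' ψ)     = SatQF ρ φ × SatQF ρ ψ
    SatQF ρ (φ ∨' ψ)     = SatQF ρ φ ⊎ SatQF ρ ψ
    SatQF ρ (φ ⇒' ψ)     = SatQF ρ φ → SatQF ρ ψ

    SatN : ∀ {n} → (Fin (suc n) → V) → Neighborhood n → Set
    SatN ρ []              = ⊤
    SatN ρ ((i , f , j) ∷ N) = E f (ρ i) (ρ j) × SatN ρ N

    SatC : Constraint → Set
    SatC k = ∀ (a : V) → RPath G R (CG c) a →
             ∀ (ρ : Fin (suc n) → V) → ρ zero ≡ a →
             SatN ρ N → SatQF ρ ψ
      where open Constraint k

    _⊨_ : LRP → Set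
    _⊨_ [ k ]    = SatC k
    _⊨_ ⊤'       = ⊤
    _⊨_ ⊥'       = ⊥
    _⊨_ (~ φ)    = ¬ (_⊨_ φ)
    _⊨_ (φ & ψ)  = _⊨_ φ × _⊨_ ψ
    _⊨_ (φ ∥ ψ)  = _⊨_ φ ⊎ _⊨_ ψ
    _⊨_ (φ ⟹ ψ) = _⊨_ φ → _⊨_ ψ

  Satisfiable : LRP → Set₁
  Satisfiable φ = Σ Graph λ G → G ⊨ φ

  FinitelySatisfiable : LRP → Set₁
  FinitelySatisfiable φ = Σ Graph λ G → IsFinite G × (G ⊨ φ)

module Submission where

-- Take the subgraph of G induced by the constants together with, for every
-- constraint of φ that G violates, the nodes of one witness of the violation:
-- the path from the constant to the offending node and the values of the
-- pattern variables.  It is finite, violated constraints stay violated (the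
-- witness survives), and satisfied ones stay satisfied, since every path and
-- every assignment of the induced subgraph is one of G and quantifier-free
-- formulas are evaluated identically along an injective embedding.  So every
-- constraint, hence φ, keeps its truth value.

open import Defs
open import Level using (0ℓ)
open import Axiom.ExcludedMiddle using (ExcludedMiddle)
open import Data.Nat using (ℕ; suc)
open import Data.Fin using (Fin; zero; suc)
open import Data.List using (List; []; _∷_; _++_; length; lookup; tabulate; deduplicate)
open import Data.List.Membership.Propositional using (_∈_)
open import Data.List.Membership.Propositional.Properties using (∈-lookup; ∈-tabulate⁺; ∈-deduplicate⁺)
open import Data.List.Relation.Unary.All as All using (All; []; _∷_)
open import Data.List.Relation.Unary.All.Properties using (++⁻; ++⁻ˡ; ++⁻ʳ)
open import Data.List.Relation.Unary.Any as Any using ()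
open import Data.List.Relation.Unary.Any.Properties using (lookup-index)
open import Data.List.Relation.Unary.AllPairs using (_∷_)
open import Data.List.Relation.Unary.Unique.Propositional using (Unique)
import Data.List.Relation.Unary.Unique.DecPropositional.Properties as UniqueDec
open import Data.Product using (Σ; ∃; _×_; _,_; proj₁; proj₂)
open import Data.Product.Function.NonDependent.Propositional using (_×-⇔_)
open import Data.Sum.Function.Propositional using (_⊎-⇔_)
open import Data.Empty using (⊥-elim)
open import Function using (_∘_)
open import Function.Bundles using (_⇔_; mk⇔; Equivalence)
open import Function.Definitions using (Injective)
open import Function.Construct.Identity using (⇔-id; ↔-id)
open import Function.Construct.Composition using (_⇔-∘_)
open import Function.Related.Propositional using (≡⇒; equivalence)
open import Function.Related.TypeIsomorphisms using (→-cong-⇔; ¬-cong-⇔)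
open import Relation.Binary.Definitions using (DecidableEquality)
open import Relation.Binary.PropositionalEquality using (_≡_; refl; sym; trans; cong; cong₂; subst)
open import Relation.Nullary using (¬_; Dec; yes; no)

open Equivalence using (to; from)

InImage : {A B : Set} → (A → B) → B → Set
InImage ι b = ∃ λ a → ι a ≡ b

lookup-injective : {A : Set} {xs : List A} → Unique xs → Injective _≡_ _≡_ (lookup xs)
lookup-injective (_ ∷ _)    {zero}  {zero}  _  = refl
lookup-injective (x∉xs ∷ _) {zero}  {suc j} eq = ⊥-elim (All.lookup x∉xs (∈-lookup j) eq)
lookup-injective (x∉xs ∷ _) {suc i} {zero}  eq = ⊥-elim (All.lookup x∉xs (∈-lookup i) (sym eq))
lookup-injective (_ ∷ !xs)  {suc i} {suc j} eq = cong suc (lookup-injective !xs eq)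

finite-cover : {A : Set} → DecidableEquality A → (xs : List A) →
               Σ ℕ λ m → Σ (Fin m → A) λ ι → Injective _≡_ _≡_ ι × All (InImage ι) xs
finite-cover _≟_ xs =
  length ys , lookup ys , lookup-injective (UniqueDec.deduplicate-! _≟_ xs) , All.tabulate covered
  where
    ys : List _
    ys = deduplicate _≟_ xs
    covered : ∀ {x} → x ∈ xs → InImage (lookup ys) x
    covered x∈xs = Any.index x∈ys , sym (lookup-index x∈ys)
      where
        x∈ys : _ ∈ ys
        x∈ys = ∈-deduplicate⁺ _≟_ x∈xs

module _ {τ : Vocabulary} (G : Graph τ) where
  open Graph G

  visited : ∀ {w a b} → WordPath τ G w a b → List V
  visited {w = []} _ = []
  visited {w = _ ∷ _} (d , _ , p) = d ∷ visited p

  record Violation (k : Constraint τ) : Set where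
    open Constraint k
    field
      node       : V
      word       : List (Letter τ)
      word∈R     : InL τ R word
      walk       : WordPath τ G word (CG c) node
      ρ          : Fin (suc n) → V
      ρ-root     : ρ zero ≡ node
      neighbours : SatN τ G ρ N
      falsified  : ¬ SatQF τ G ρ ψ

  violationNodes : ∀ {k} → Violation k → List V
  violationNodes v = visited walk ++ tabulate ρ
    where open Violation v

  violation⇒¬sat : ∀ {k} → Violation k → ¬ SatC τ G k
  violation⇒¬sat v sat = falsified (sat node (word , word∈R , walk) ρ ρ-root neighbours)
    where open Violation v

  ¬violation⇒sat : ExcludedMiddle 0ℓ → ∀ {k} → ¬ Violation k → SatC τ G k
  ¬violation⇒sat lem ¬v a (w , w∈R , p) ρ root nbh with lem
  ... | yes holds = holds
  ... | no fails = ⊥-elim (¬v (record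
    { node = a ; word = w ; word∈R = w∈R ; walk = p
    ; ρ = ρ ; ρ-root = root ; neighbours = nbh ; falsified = fails }))

  constraintSupport : ∀ {k} → Dec (Violation k) → List V
  constraintSupport (yes v) = violationNodes v
  constraintSupport (no _)  = []

  support : ExcludedMiddle 0ℓ → LRP τ → List V
  support lem [ k ]   = constraintSupport (lem {Violation k})
  support lem ⊤'      = []
  support lem ⊥'      = []
  support lem (~ φ)   = support lem φ
  support lem (φ & ψ) = support lem φ ++ support lem ψ
  support lem (φ ∥ ψ) = support lem φ ++ support lem ψ
  support lem (φ ⟹ ψ) = support lem φ ++ support lem ψ

module Induced {τ : Vocabulary} (G : Graph τ) {W : Set} (ι : W → Graph.V G)
               (ι-injective : Injective _≡_ _≡_ ι)
               (const-in : ∀ c → InImage ι (Graph.CG G c)) where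
  open Graph G

  induced : Graph τ
  induced = record
    { V  = W
    ; E  = λ f x y → E f (ι x) (ι y)
    ; CG = λ c → proj₁ (const-in c)
    ; UG = λ u x → UG u (ι x)
    }

  ι-const : ∀ c → ι (Graph.CG induced c) ≡ CG c
  ι-const c = proj₂ (const-in c)

  ι-≡⇔ : ∀ {x y} → x ≡ y ⇔ ι x ≡ ι y
  ι-≡⇔ = mk⇔ (cong ι) ι-injective

  ι-const⇔ : ∀ {x} c → x ≡ Graph.CG induced c ⇔ ι x ≡ CG c
  ι-const⇔ c = ≡⇒ {k = equivalence} (cong (_ ≡_) (ι-const c)) ⇔-∘ ι-≡⇔

  letterPath⇔ : ∀ l {x y} → LetterPath τ induced l x y ⇔ LetterPath τ G l (ι x) (ι y)
  letterPath⇔ (fwd f)  = ⇔-id _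
  letterPath⇔ (bwd f)  = ⇔-id _
  letterPath⇔ (pos u)  = ι-≡⇔ ×-⇔ ⇔-id _
  letterPath⇔ (neg u)  = ι-≡⇔ ×-⇔ ⇔-id _
  letterPath⇔ (isC c)  = ι-≡⇔ ×-⇔ ι-const⇔ c
  letterPath⇔ (notC c) = ι-≡⇔ ×-⇔ ¬-cong-⇔ (ι-const⇔ c)

  wordPath↓ : ∀ w {x y} → WordPath τ induced w x y → WordPath τ G w (ι x) (ι y)
  wordPath↓ []      p              = cong ι p
  wordPath↓ (l ∷ w) (z , step , p) = ι z , to (letterPath⇔ l) step , wordPath↓ w p

  wordPath↑ : ∀ w {x a b} → ι x ≡ a → (p : WordPath τ G w a b) → All (InImage ι) (visited G p) →
              ∃ λ y → ι y ≡ b × WordPath τ induced w x y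
  wordPath↑ []      ιx≡a refl             []                 = _ , ιx≡a , refl
  wordPath↑ (l ∷ w) refl (_ , step , p) ((z , refl) ∷ cov) =
    let (y , ιy≡b , p′) = wordPath↑ w refl p cov in
    y , ιy≡b , (z , from (letterPath⇔ l) step , p′)

  module _ {n} {ρ′ : Fin (suc n) → W} {ρ : Fin (suc n) → V} (ρ′≗ρ : ∀ i → ι (ρ′ i) ≡ ρ i) where

    term-ι : (t : Term τ n) → ι (⟦_⟧T τ induced t ρ′) ≡ ⟦_⟧T τ G t ρ
    term-ι (var i)   = ρ′≗ρ i
    term-ι (const c) = ι-const c

    satQF⇔ : (φ : QF τ n) → SatQF τ induced ρ′ φ ⇔ SatQF τ G ρ φ
    satQF⇔ (t ≐ t′)      = ≡⇒ {k = equivalence} (cong₂ _≡_ (term-ι t) (term-ι t′)) ⇔-∘ ι-≡⇔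
    satQF⇔ (unary u t)   = ≡⇒ {k = equivalence} (cong (UG u) (term-ι t))
    satQF⇔ (edge t f t′) = ≡⇒ {k = equivalence} (cong₂ (E f) (term-ι t) (term-ι t′))
    satQF⇔ true          = ⇔-id _
    satQF⇔ false         = ⇔-id _
    satQF⇔ (¬' φ)        = ¬-cong-⇔ (satQF⇔ φ)
    satQF⇔ (φ ∧' ψ)      = satQF⇔ φ ×-⇔ satQF⇔ ψ
    satQF⇔ (φ ∨' ψ)      = satQF⇔ φ ⊎-⇔ satQF⇔ ψ
    satQF⇔ (φ ⇒' ψ)      = →-cong-⇔ (satQF⇔ φ) (satQF⇔ ψ)

    satN⇔ : (N : Neighborhood τ n) → SatN τ induced ρ′ N ⇔ SatN τ G ρ N
    satN⇔ []                = ⇔-id _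
    satN⇔ ((i , f , j) ∷ N) = ≡⇒ {k = equivalence} (cong₂ (E f) (ρ′≗ρ i) (ρ′≗ρ j)) ×-⇔ satN⇔ N

  satC↓ : ∀ k → SatC τ G k → SatC τ induced k
  satC↓ k sat x (w , w∈R , p) ρ′ root nbh =
    from (satQF⇔ (λ _ → refl) ψ)
      (sat (ι x) (w , w∈R , subst (λ a → WordPath τ G w a (ι x)) (ι-const c) (wordPath↓ w p))
           (ι ∘ ρ′) (cong ι root) (to (satN⇔ (λ _ → refl) N) nbh))
    where open Constraint k

  violation↑ : ∀ {k} (v : Violation G k) → All (InImage ι) (violationNodes G v) → ¬ SatC τ induced k
  violation↑ {k} v cov sat =
    let (y , ιy≡node , walk′) = lifted
        ρ′-root : ρ′ zero ≡ y
        ρ′-root = ι-injective (trans (ρ′≗ρ zero) (trans ρ-root (sym ιy≡node)))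
    in falsified (to (satQF⇔ ρ′≗ρ ψ)
         (sat y (word , word∈R , walk′) ρ′ ρ′-root (from (satN⇔ ρ′≗ρ N) neighbours)))
    where
      open Constraint k
      open Violation v
      lifted : ∃ λ y → ι y ≡ node × WordPath τ induced word (Graph.CG induced c) y
      lifted = wordPath↑ word (ι-const c) walk (++⁻ˡ (visited G walk) cov)
      ρ-in : ∀ i → InImage ι (ρ i)
      ρ-in i = All.lookup (++⁻ʳ (visited G walk) cov) (∈-tabulate⁺ {f = ρ} i)
      ρ′ : Fin (suc n) → W
      ρ′ = proj₁ ∘ ρ-in
      ρ′≗ρ : ∀ i → ι (ρ′ i) ≡ ρ i
      ρ′≗ρ = proj₂ ∘ ρ-in

  module _ (lem : ExcludedMiddle 0ℓ) where

    satC⇔ : ∀ k (d : Dec (Violation G k)) → All (InImage ι) (constraintSupport G d) →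
            SatC τ G k ⇔ SatC τ induced k
    satC⇔ k (yes v) cov = mk⇔ (⊥-elim ∘ violation⇒¬sat G v) (⊥-elim ∘ violation↑ v cov)
    satC⇔ k (no ¬v) _   = mk⇔ (satC↓ k) (λ _ → ¬violation⇒sat G lem ¬v)

    ⊨⇔ : ∀ φ → All (InImage ι) (support G lem φ) → _⊨_ τ G φ ⇔ _⊨_ τ induced φ
    ⊨⇔ [ k ]   cov = satC⇔ k lem cov
    ⊨⇔ ⊤'      _   = ⇔-id _
    ⊨⇔ ⊥'      _   = ⇔-id _
    ⊨⇔ (~ φ)   cov = ¬-cong-⇔ (⊨⇔ φ cov)
    ⊨⇔ (φ & ψ) cov = ⊨⇔ φ (++⁻ˡ _ cov) ×-⇔ ⊨⇔ ψ (++⁻ʳ _ cov)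
    ⊨⇔ (φ ∥ ψ) cov = ⊨⇔ φ (++⁻ˡ _ cov) ⊎-⇔ ⊨⇔ ψ (++⁻ʳ _ cov)
    ⊨⇔ (φ ⟹ ψ) cov = →-cong-⇔ (⊨⇔ φ (++⁻ˡ _ cov)) (⊨⇔ ψ (++⁻ʳ _ cov))

theorem1 : ExcludedMiddle 0ℓ → (τ : Vocabulary) → (φ : LRP τ) →
    Satisfiable τ φ → FinitelySatisfiable τ φ
theorem1 lem τ φ (G , G⊨φ)
  with finite-cover (λ _ _ → lem) (tabulate (Graph.CG G) ++ support G lem φ)
... | m , ι , ι-injective , covered
  with ++⁻ (tabulate (Graph.CG G)) covered
... | consts-covered , support-covered =
  induced , (m , ↔-id _) , to (⊨⇔ lem φ support-covered) G⊨φ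
  where open Induced G ι ι-injective (λ c → All.lookup consts-covered (∈-tabulate⁺ {f = Graph.CG G} c))
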